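{- Let $g:\{0,\dots,n\}^2\to\mathbb{R}$ be supermodular with $g(i,0)=g(0,j)=0$ for all $i,j$. Let $f$ be the unique tropically polarized function on $\Pi$ with $f\circ\alpha=g$, and let $h=f\circ\beta$. Then $h$ is inframodular, $h(i,0)=h(0,j)=0$ for all $i,j$, and $h(n-1,n-1)\le h(n,n)$. Conversely, if $h:\{0,\dots,n\}^2\to\mathbb{R}$ is inframodular, $h(i,0)=h(0,j)=0$ for all $i,j$, and $h(n-1,n-1)\le h(n,n)$, and $f$ is the unique tropically polarized function with $f\circ\beta=h$, then $g=f\circ\alpha$ is supermodular (and vanishes when $ij=0$).
   Context: $\Pi$ is the set of integer points $(i,j,k)$ with $0\le k\le n$, $k\le i,j\le 2n-k$, and $i\equiv j\equiv k \pmod 2$. A center of an elementary octahedron is an integer point $(i,j,k)$ with $1\le k\le n-1$, $k+1\le i,j\le 2n-k-1$, $i\equiv j\equiv k+1\pmod 2$. A function $f:\Pi\to\mathbb{R}$ is tropically polarized if $f(i,j,0)=0$ for all $(i,j,0)\in\Pi$ and for every center $(i,j,k)$ of an elementary octahedron $$f(i-1,j-1,k)+f(i+1,j+1,k)=\max\bigl(f(i,j,k-1)+f(i,j,k+1),\ f(i-1,j+1,k)+f(i+1,j-1,k)\bigr).$$ The maps $\alpha,\beta:\{0,\dots,n\}^2\to\Pi$ are $\alpha(i,j)=(2i-\min(i,j),\,2j-\min(i,j),\,\min(i,j))$ and $\beta(i,j)=(2n-2i+\min(i,j),\,2n-2j+\min(i,j),\,\min(i,j))$. For every function $g$ (resp.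 $h$) on $\{0,\dots,n\}^2$ vanishing when $ij=0$ there is a unique tropically polarized $f$ with $f\circ\alpha=g$ (resp. $f\circ\beta=h$). A function $g$ on $\{0,\dots,n\}^2$ is supermodular if $g(i,j)-g(i-1,j)-g(i,j-1)+g(i-1,j-1)\ge0$ for all $1\le i,j\le n$. A function $h$ on $\{0,\dots,n\}^2$ is inframodular if $h(i,j)+h(i+1,j)\ge h(i,j-1)+h(i+1,j+1)$ and $h(i,j)+h(i,j+1)\ge h(i-1,j)+h(i+1,j+1)$ whenever all terms involved are defined (i.e. all arguments lie in $\{0,\dots,n\}^2$). -}

module Defs where

open import Level using (Level; _⊔_)
open import Data.Nat as ℕ using (ℕ; zero; suc; _∸_; _*_; _%_; _⊓_)
import Data.Nat as N
open import Data.Product using (_×_; _,_)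
open import Data.Sum using (_⊎_)
open import Relation.Binary.Core using (Rel)
open import Relation.Binary.Structures using (IsTotalOrder)
open import Relation.Binary.PropositionalEquality using (_≡_)
open import Algebra.Bundles using (AbelianGroup)

-- The real numbers are not available in agda-stdlib.  We work over an
-- arbitrary totally ordered abelian group (ℝ with + and ≤ is one).
record OrderedAbelianGroup (c ℓ₁ ℓ₂ : Level) : Set (Level.suc (c ⊔ ℓ₁ ⊔ ℓ₂)) where
  field
    abelianGroup : AbelianGroup c ℓ₁
  open AbelianGroup abelianGroup public
  field
    _≤_          : Rel Carrier ℓ₂
    isTotalOrder : IsTotalOrder _≈_ _≤_
    ∙-monoˡ-≤    : ∀ {x y} z → x ≤ y → (x ∙ z) ≤ (y ∙ z)

module OAG {c ℓ₁ ℓ₂} (G : OrderedAbelianGroup c ℓ₁ ℓ₂) (n : ℕ) where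
  open OrderedAbelianGroup G

  IsMax : Carrier → Carrier → Carrier → Set (ℓ₁ ⊔ ℓ₂)
  IsMax a b c' = (b ≤ a × c' ≤ a) × (a ≈ b ⊎ a ≈ c')

  -- functions on Π are represented as functions on ℕ³; only their values on
  -- Π are ever used.
  Fun3 : Set c
  Fun3 = ℕ → ℕ → ℕ → Carrier

  Fun2 : Set c
  Fun2 = ℕ → ℕ → Carrier

  IsCenter : ℕ → ℕ → ℕ → Set
  IsCenter i j k =
    (1 N.≤ k × k N.≤ n ∸ 1) ×
    ((k + 1 N.≤ i × i N.≤ 2 * n ∸ k ∸ 1) × (k + 1 N.≤ j × j N.≤ 2 * n ∸ k ∸ 1)) ×
    (i % 2 ≡ (k + 1) % 2 × j % 2 ≡ (k + 1) % 2)
    where open N using (_+_)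

  TropicallyPolarized : Fun3 → Set (ℓ₁ ⊔ ℓ₂)
  TropicallyPolarized f =
    (∀ i j → i N.≤ 2 * n → j N.≤ 2 * n → i % 2 ≡ 0 → j % 2 ≡ 0 → f i j 0 ≈ ε)
    × (∀ i j k → IsCenter (suc i) (suc j) k →
         IsMax (f i j k ∙ f (suc (suc i)) (suc (suc j)) k)
               (f (suc i) (suc j) (k ∸ 1) ∙ f (suc i) (suc j) (suc k))
               (f i (suc (suc j)) k ∙ f (suc (suc i)) j k))

  α₃ : ℕ → ℕ → ℕ × ℕ × ℕ
  α₃ i j = (2 * i ∸ (i ⊓ j) , 2 * j ∸ (i ⊓ j) , i ⊓ j)

  β₃ : ℕ → ℕ → ℕ × ℕ × ℕ
  β₃ i j = ((2 * n ∸ 2 * i) N.+ (i ⊓ j) , (2 * n ∸ 2 * j) N.+ (i ⊓ j) , i ⊓ j)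

  app : Fun3 → ℕ × ℕ × ℕ → Carrier
  app f (a , b , k) = f a b k

  _∘α : Fun3 → Fun2
  (f ∘α) i j = app f (α₃ i j)

  _∘β : Fun3 → Fun2
  (f ∘β) i j = app f (β₃ i j)

  -- g(i,j) - g(i-1,j) - g(i,j-1) + g(i-1,j-1) ≥ 0, for 1 ≤ i,j ≤ n,
  -- written without subtraction as  g(i-1,j) + g(i,j-1) ≤ g(i,j) + g(i-1,j-1)
  Supermodular : Fun2 → Set ℓ₂
  Supermodular g = ∀ i j → suc i N.≤ n → suc j N.≤ n →
    (g i (suc j) ∙ g (suc i) j) ≤ (g (suc i) (suc j) ∙ g i j)

  Inframodular : Fun2 → Set ℓ₂
  Inframodular h =
    (∀ i j → suc i N.≤ n → suc (suc j) N.≤ n →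
       (h i j ∙ h (suc i) (suc (suc j))) ≤ (h i (suc j) ∙ h (suc i) (suc j)))
    × (∀ i j → suc (suc i) N.≤ n → suc j N.≤ n →
       (h i j ∙ h (suc (suc i)) (suc j)) ≤ (h (suc i) j ∙ h (suc i) (suc j)))

  VanishesOnAxes : Fun2 → Set ℓ₁
  VanishesOnAxes g = (∀ i → i N.≤ n → g i 0 ≈ ε) × (∀ j → j N.≤ n → g 0 j ≈ ε)

-- Index Π by columns: the column (X, Y), for X, Y ≤ n, consists of the points
-- (2X − k, 2Y − k, k) with k ≤ X ⊓ Y. Then f ∘ α reads the tops of the columns, while
-- f ∘ β reads, along the diagonal j = i + d, the column (n, n − d) (and (n − d, n)
-- below the diagonal). Call neighbouring columns l, u interlaced when their increments
-- alternate: Δu (k+1) ≤ Δl k ≤ Δu k. On a unit cell with columns l = (X, Y),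
-- u = (X+1, Y), v = (X, Y+1), r = (X+1, Y+1) the octahedron recurrence, rewritten as
-- inequalities between differences and added up, shows: if l is interlaced with u and v
-- and the tops of the cell are supermodular, then u and v are interlaced with r; and
-- conversely, interlacing of u and v with r gives interlacing of l with u and v together
-- with supermodularity of the tops. On the diagonal X = Y one also propagates that the
-- last increment of the column is nonnegative. Induction from the corner (0, 0), resp.
-- from the faces X = n and Y = n, turns supermodularity of g into interlacing of the
-- columns over those two faces plus a nonnegative last increment at (n, n), and back;
-- these are, term by term, inframodularity of h and h (n−1, n−1) ≤ h (n, n).
module Submission where

open import Defs
open import Level using (Level)
open import Data.Nat using (ℕ; _∸_)
open import Data.Product using (_×_; _,_; proj₁; proj₂)
import Data.Nat as Nat
import Data.Nat.Properties as Natₚ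
open import Data.Nat.DivMod using ([m+kn]%n≡m%n; m*n%n≡0)
open import Data.Nat.Tactic.RingSolver using (solve)
open import Data.List using (_∷_; [])
open import Data.Sum using (_⊎_; inj₁; inj₂; map; map₂)
import Relation.Binary.PropositionalEquality as ≡
open ≡ using (_≡_)
open import Relation.Binary.Structures using (IsTotalOrder)
open import Function using (flip)
import Algebra.Properties.Group as GroupProperties
import Algebra.Properties.CommutativeSemigroup as CommutativeSemigroupProperties

module OrderedAbelianGroupProperties {c ℓ₁ ℓ₂} (G : OrderedAbelianGroup c ℓ₁ ℓ₂) where
  open OrderedAbelianGroup G
  open IsTotalOrder isTotalOrder using () renaming (trans to ≤-trans; reflexive to ≤-reflexive)
  open GroupProperties group using (//-rightDividesʳ)
  open CommutativeSemigroupProperties commutativeSemigroup using (interchange)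

  ≤-resp-≈ : ∀ {x x′ y y′} → x ≈ x′ → y ≈ y′ → x ≤ y → x′ ≤ y′
  ≤-resp-≈ x≈x′ y≈y′ x≤y = ≤-trans (≤-reflexive (sym x≈x′)) (≤-trans x≤y (≤-reflexive y≈y′))

  ∙-monoʳ-≤ : ∀ {x y} z → x ≤ y → (z ∙ x) ≤ (z ∙ y)
  ∙-monoʳ-≤ {x} {y} z x≤y = ≤-resp-≈ (comm x z) (comm y z) (∙-monoˡ-≤ z x≤y)

  ∙-mono-≤ : ∀ {x y z w} → x ≤ y → z ≤ w → (x ∙ z) ≤ (y ∙ w)
  ∙-mono-≤ {y = y} {z} x≤y z≤w = ≤-trans (∙-monoˡ-≤ z x≤y) (∙-monoʳ-≤ y z≤w)

  ∙-cancelʳ-≤ : ∀ {x y} z → (x ∙ z) ≤ (y ∙ z) → x ≤ y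
  ∙-cancelʳ-≤ {x} {y} z x∙z≤y∙z =
    ≤-resp-≈ (//-rightDividesʳ z x) (//-rightDividesʳ z y) (∙-monoˡ-≤ (z ⁻¹) x∙z≤y∙z)

  -- x ⊖ y ≼ z ⊖ w stands for x - y ≤ z - w, written without inverses: it unfolds to
  -- x ∙ w ≤ z ∙ y, so every inequality between two sums of two terms is of this form.
  infix 4 _⊖_≼_⊖_
  _⊖_≼_⊖_ : Carrier → Carrier → Carrier → Carrier → Set ℓ₂
  x ⊖ y ≼ z ⊖ w = (x ∙ w) ≤ (z ∙ y)

  ≼-resp-≈ : ∀ {x x′ y y′ z z′ w w′} → x ≈ x′ → y ≈ y′ → z ≈ z′ → w ≈ w′ →
             x ⊖ y ≼ z ⊖ w → x′ ⊖ y′ ≼ z′ ⊖ w′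
  ≼-resp-≈ x≈x′ y≈y′ z≈z′ w≈w′ = ≤-resp-≈ (∙-cong x≈x′ w≈w′) (∙-cong z≈z′ y≈y′)

  ≼-swap₁₄ : ∀ {x y z w} → x ⊖ y ≼ z ⊖ w → w ⊖ y ≼ z ⊖ x
  ≼-swap₁₄ {x} {w = w} = ≤-resp-≈ (comm x w) refl

  ≼-swap₂₃ : ∀ {x y z w} → x ⊖ y ≼ z ⊖ w → x ⊖ z ≼ y ⊖ w
  ≼-swap₂₃ {y = y} {z} = ≤-resp-≈ refl (comm z y)

  ≼-neg : ∀ {x y z w} → x ⊖ y ≼ z ⊖ w → w ⊖ z ≼ y ⊖ x
  ≼-neg x-y≤z-w = ≼-swap₂₃ (≼-swap₁₄ x-y≤z-w)

  ≼-telescope : ∀ {x y y′ z w w′} → x ⊖ y ≼ z ⊖ w → y ⊖ y′ ≼ w ⊖ w′ → x ⊖ y′ ≼ z ⊖ w′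
  ≼-telescope {x} {y} {y′} {z} {w} {w′} x-y≤z-w y-y′≤w-w′ = ∙-cancelʳ-≤ (w ∙ y)
    (≤-resp-≈ (trans (exchange x w y w′) (∙-congˡ (comm y w))) (exchange z y w y′) (∙-mono-≤ x-y≤z-w y-y′≤w-w′))
    where
    exchange : ∀ a b c d → ((a ∙ b) ∙ (c ∙ d)) ≈ ((a ∙ d) ∙ (c ∙ b))
    exchange a b c d = trans (interchange a b c d) (trans (∙-congˡ (comm b d)) (sym (interchange a d c b)))

  ≼-trans : ∀ {x y z w s t} → x ⊖ y ≼ z ⊖ w → z ⊖ w ≼ s ⊖ t → x ⊖ y ≼ s ⊖ t
  ≼-trans x-y≤z-w z-w≤s-t = ≼-swap₂₃ (≼-telescope (≼-swap₂₃ x-y≤z-w) (≼-swap₂₃ z-w≤s-t))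

  ≤⇒≼ : ∀ {x x′} y → x ≤ x′ → x ⊖ y ≼ x′ ⊖ y
  ≤⇒≼ y = ∙-monoˡ-≤ y

  ≼⇒≤ : ∀ {x z w} → x ⊖ x ≼ z ⊖ w → w ≤ z
  ≼⇒≤ {x} {z} {w} 0≤z-w = ∙-cancelʳ-≤ x (≤-resp-≈ (comm x w) refl 0≤z-w)

module Coordinates where
  open Nat using (zero; suc; _+_; _*_; _%_; _⊓_; _≤_; s≤s)
  open Natₚ
    using (m≤n⇒∃[o]m+o≡n; m+n∸m≡n; m+n≤o⇒m≤o∸n; ∸-+-assoc; +-∸-assoc; m≤m+n; m≤n+m; m≤n*m; ≤-trans; <⇒≤;
           +-comm; *-comm; *-suc; suc-injective)
  open ≡ using (refl; cong; subst; sym; trans; module ≡-Reasoning)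

  2*m%2≡0 : ∀ m → (2 * m) % 2 ≡ 0
  2*m%2≡0 m = trans (cong (_% 2) (*-comm 2 m)) (m*n%n≡0 m 2)

  m≡n+o⇒m∸n≡o : ∀ {m} n {o} → m ≡ n + o → m ∸ n ≡ o
  m≡n+o⇒m∸n≡o n {o} m≡n+o = trans (cong (_∸ n) m≡n+o) (m+n∸m≡n n o)

  2*[m+n]∸m≡m+2*n : ∀ m n → 2 * (m + n) ∸ m ≡ m + 2 * n
  2*[m+n]∸m≡m+2*n m n = m≡n+o⇒m∸n≡o m (solve (m ∷ n ∷ []))

  m≤n⇒m≤2*n : ∀ {m n} → m ≤ n → m ≤ 2 * n
  m≤n⇒m≤2*n {n = n} m≤n = ≤-trans m≤n (m≤n*m n 2)

  d+m≡n⇒m≤n : ∀ {d m n} → d + m ≡ n → m ≤ n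
  d+m≡n⇒m≤n {d} {m} d+m≡n = subst (m ≤_) d+m≡n (m≤n+m m d)

  <⇒≤∸1 : ∀ {m n} → suc m ≤ n → m ≤ n ∸ 1
  <⇒≤∸1 (s≤s m≤n) = m≤n

  suc-m⊓m≡m⊓m : ∀ m → suc m ⊓ m ≡ m ⊓ m
  suc-m⊓m≡m⊓m zero    = refl
  suc-m⊓m≡m⊓m (suc m) = cong suc (suc-m⊓m≡m⊓m m)

  m⊓suc-m≡m⊓m : ∀ m → m ⊓ suc m ≡ m ⊓ m
  m⊓suc-m≡m⊓m zero    = refl
  m⊓suc-m≡m⊓m (suc m) = cong suc (m⊓suc-m≡m⊓m m)

  suc-m⊓n≡m⊓suc-n⇒m≡n : ∀ m n → suc m ⊓ n ≡ m ⊓ suc n → m ≡ n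
  suc-m⊓n≡m⊓suc-n⇒m≡n zero    zero    _ = refl
  suc-m⊓n≡m⊓suc-n⇒m≡n zero    (suc n) ()
  suc-m⊓n≡m⊓suc-n⇒m≡n (suc m) zero    ()
  suc-m⊓n≡m⊓suc-n⇒m≡n (suc m) (suc n) e = cong suc (suc-m⊓n≡m⊓suc-n⇒m≡n m n (suc-injective e))

  column-coordinates : ∀ {k X} → suc k ≤ X →
    suc (2 * X ∸ suc k) ≡ 2 * X ∸ k × suc (suc (2 * X ∸ suc k)) ≡ 2 * suc X ∸ suc k ×
    suc (2 * X ∸ suc k) ≡ 2 * suc X ∸ suc (suc k)
  column-coordinates {k} {X} k<X = lower , upper , upper′
    where
    lower : suc (2 * X ∸ suc k) ≡ 2 * X ∸ k
    lower = sym (+-∸-assoc 1 (m≤n⇒m≤2*n k<X))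
    upper : suc (suc (2 * X ∸ suc k)) ≡ 2 * suc X ∸ suc k
    upper = begin
      suc (suc (2 * X ∸ suc k)) ≡⟨ cong suc lower ⟩
      suc (2 * X ∸ k)           ≡⟨ +-∸-assoc 1 (m≤n⇒m≤2*n (<⇒≤ k<X)) ⟨
      suc (2 * X) ∸ k           ≡⟨ cong (_∸ suc k) (*-suc 2 X) ⟨
      2 * suc X ∸ suc k         ∎
      where open ≡-Reasoning
    upper′ : suc (2 * X ∸ suc k) ≡ 2 * suc X ∸ suc (suc k)
    upper′ = trans lower (cong (_∸ suc (suc k)) (sym (*-suc 2 X)))

  center-coordinate : ∀ {N X k} → suc X ≤ N → suc k ≤ X →
    (suc k + 1 ≤ suc (2 * X ∸ suc k) × suc (2 * X ∸ suc k) ≤ 2 * N ∸ suc k ∸ 1) ×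
    suc (2 * X ∸ suc k) % 2 ≡ (suc k + 1) % 2
  center-coordinate {k = k} X<N k<X with m≤n⇒∃[o]m+o≡n k<X
  ... | p , refl with m≤n⇒∃[o]m+o≡n X<N
  ... | q , refl rewrite 2*[m+n]∸m≡m+2*n (suc k) p = (lower-bound , upper-bound) , same-parity
    where
    lower-bound : suc k + 1 ≤ suc (suc k + 2 * p)
    lower-bound = subst (_≤ suc (suc k + 2 * p)) (+-comm 1 (suc k)) (s≤s (s≤s (m≤m+n k (2 * p))))
    upper-bound : suc (suc k + 2 * p) ≤ 2 * (suc (suc k + p) + q) ∸ suc k ∸ 1
    upper-bound = subst (suc (suc k + 2 * p) ≤_) (sym (∸-+-assoc (2 * (suc (suc k + p) + q)) (suc k) 1))
      (m+n≤o⇒m≤o∸n _ (subst (suc (suc k + 2 * p) + (suc k + 1) ≤_) (sym expand) (m≤m+n _ (2 * q))))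
      where
      expand : 2 * (suc (suc k + p) + q) ≡ suc (suc k + 2 * p) + (suc k + 1) + 2 * q
      expand = solve (k ∷ p ∷ q ∷ [])
    same-parity : suc (suc k + 2 * p) % 2 ≡ (suc k + 1) % 2
    same-parity = trans (cong (_% 2) expand) ([m+kn]%n≡m%n (suc k + 1) p 2)
      where
      expand : suc (suc k + 2 * p) ≡ suc k + 1 + p * 2
      expand = solve (k ∷ p ∷ [])

  β-coordinates : ∀ {N Y d k} → Y + d ≡ N → k ≤ Y →
    (2 * N ∸ 2 * k) + k ≡ 2 * N ∸ k × (2 * N ∸ 2 * (k + d)) + k ≡ 2 * Y ∸ k
  β-coordinates {d = d} {k} refl k≤Y with m≤n⇒∃[o]m+o≡n k≤Y
  ... | p , refl = first , second
    where
    open ≡-Reasoning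
    first : (2 * (k + p + d) ∸ 2 * k) + k ≡ 2 * (k + p + d) ∸ k
    first = begin
      (2 * (k + p + d) ∸ 2 * k) + k ≡⟨ cong (_+ k) (m≡n+o⇒m∸n≡o (2 * k) (solve (k ∷ p ∷ d ∷ []))) ⟩
      2 * (p + d) + k               ≡⟨ +-comm (2 * (p + d)) k ⟩
      k + 2 * (p + d)               ≡⟨ m≡n+o⇒m∸n≡o k (solve (k ∷ p ∷ d ∷ [])) ⟨
      2 * (k + p + d) ∸ k           ∎
    second : (2 * (k + p + d) ∸ 2 * (k + d)) + k ≡ 2 * (k + p) ∸ k
    second = begin
      (2 * (k + p + d) ∸ 2 * (k + d)) + k ≡⟨ cong (_+ k) (m≡n+o⇒m∸n≡o (2 * (k + d)) (solve (k ∷ p ∷ d ∷ []))) ⟩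
      2 * p + k                           ≡⟨ +-comm (2 * p) k ⟩
      k + 2 * p                           ≡⟨ 2*[m+n]∸m≡m+2*n k p ⟨
      2 * (k + p) ∸ k                     ∎

module Columns {c ℓ₁ ℓ₂} (G : OrderedAbelianGroup c ℓ₁ ℓ₂) where
  open OrderedAbelianGroup G hiding (_≤_; refl)
  open OrderedAbelianGroup G using () renaming (_≤_ to _≤ᴳ_)
  open OrderedAbelianGroupProperties G
  open IsTotalOrder isTotalOrder using () renaming (refl to ≤ᴳ-refl)
  open Nat using (zero; suc; _≤_; _<_; s≤s)
  open Natₚ using (≤-refl; ≤-trans; <⇒≤; ≤-pred; n≤1+n; m≤n⇒m<n∨m≡n)
  open ≡ using (refl)

  record Interlaced (l u : ℕ → Carrier) (a b : ℕ) : Set ℓ₂ where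
    field
      lower : ∀ k → k < a → l (suc k) ⊖ l k ≼ u (suc k) ⊖ u k
      upper : ∀ k → suc k < b → k < a → u (suc (suc k)) ⊖ u (suc k) ≼ l (suc k) ⊖ l k

  interlaced-heights : ∀ {l u a b a′ b′} → a ≡ a′ → b ≡ b′ → Interlaced l u a b → Interlaced l u a′ b′
  interlaced-heights refl refl interlaced = interlaced

  interlaced-from-zero : ∀ {l u b} → Interlaced l u 0 b
  interlaced-from-zero = record { lower = λ _ () ; upper = λ _ _ () }

  -- For m = 0 this is r 0 ≤ r 0, by truncated subtraction.
  LastStepRises : (ℕ → Carrier) → ℕ → Set ℓ₂
  LastStepRises r m = r (m ∸ 1) ≤ᴳ r m

  -- The octahedron recurrence  l (k+1) + r (k+1) = max (l k + r (k+2), u (k+1) + v (k+1))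
  -- for k < m, with  l 0 + r 0 = u 0 + v 0, split into inequalities between differences.
  record OctahedronCell (l u v r : ℕ → Carrier) (m : ℕ) : Set ℓ₂ where
    field
      base      : l 0 ⊖ u 0 ≼ v 0 ⊖ r 0
      cross≤    : ∀ k → k ≤ m → u k ⊖ l k ≼ r k ⊖ v k
      vertical≤ : ∀ k → k < m → r (suc (suc k)) ⊖ r (suc k) ≼ l (suc k) ⊖ l k
      attained  : ∀ k → k < m →
        (l (suc k) ⊖ l k ≼ r (suc (suc k)) ⊖ r (suc k)) ⊎ (l (suc k) ⊖ u (suc k) ≼ v (suc k) ⊖ r (suc k))

  OctahedronCell-swap : ∀ {l u v r m} → OctahedronCell l u v r m → OctahedronCell l v u r m
  OctahedronCell-swap cell = record
    { base      = ≼-swap₂₃ base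
    ; cross≤    = λ k k≤m → ≼-swap₁₄ (cross≤ k k≤m)
    ; vertical≤ = vertical≤
    ; attained  = λ k k<m → map₂ ≼-swap₂₃ (attained k k<m)
    }
    where open OctahedronCell cell

  TopSupermodular : (l u v r : ℕ → Carrier) (m a b : ℕ) → Set ℓ₂
  TopSupermodular l u v r m a b = v b ⊖ l m ≼ r (suc m) ⊖ u a

  data Heights (m : ℕ) : ℕ → ℕ → Set where
    first-taller  : Heights m (suc m) m
    second-taller : Heights m m (suc m)
    equal         : Heights m m m

  Heights-swap : ∀ {m a b} → Heights m a b → Heights m b a
  Heights-swap first-taller  = second-taller
  Heights-swap second-taller = first-taller
  Heights-swap equal         = equal

  Heights-suc : ∀ {m a b} → Heights m a b → Heights (suc m) (suc a) (suc b)
  Heights-suc first-taller  = first-taller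
  Heights-suc second-taller = second-taller
  Heights-suc equal         = equal

  Heights⇒a≤1+m : ∀ {m a b} → Heights m a b → a ≤ suc m
  Heights⇒a≤1+m first-taller  = ≤-refl
  Heights⇒a≤1+m second-taller = n≤1+n _
  Heights⇒a≤1+m equal         = n≤1+n _

  Heights⇒m≤a : ∀ {m a b} → Heights m a b → m ≤ a
  Heights⇒m≤a first-taller  = n≤1+n _
  Heights⇒m≤a second-taller = ≤-refl
  Heights⇒m≤a equal         = ≤-refl

  module _ {l u v r : ℕ → Carrier} {m : ℕ} (cell : OctahedronCell l u v r m) where
    open OctahedronCell cell

    cross-below : ∀ {b} → Interlaced l v m b → ∀ k → k < m → u (suc k) ⊖ l k ≼ r (suc k) ⊖ v k
    cross-below lv k k<m = ≼-telescope (cross≤ (suc k) k<m) (Interlaced.lower lv k k<m)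

    cross-up : ∀ {a b} → Heights m a b → Interlaced l v m b → TopSupermodular l u v r m a b →
               ∀ k → k < a → u (suc k) ⊖ l k ≼ r (suc k) ⊖ v k
    cross-up first-taller lv top k k<1+m with m≤n⇒m<n∨m≡n (≤-pred k<1+m)
    ... | inj₁ k<m  = cross-below lv k k<m
    ... | inj₂ refl = ≼-swap₁₄ top
    cross-up second-taller lv _ = cross-below lv
    cross-up equal         lv _ = cross-below lv

    interlaced-up : ∀ {a b} → Heights m a b → Interlaced l u m a → Interlaced l v m b →
                    TopSupermodular l u v r m a b → Interlaced u r a (suc m)
    interlaced-up {a} heights lu lv top = record { lower = lower ; upper = upper }
      where
      cross : ∀ k → k < a → u (suc k) ⊖ l k ≼ r (suc k) ⊖ v k
      cross = cross-up heights lv top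
      below-m : ∀ {k} → suc k < a → k < m
      below-m 1+k<a = ≤-pred (≤-trans 1+k<a (Heights⇒a≤1+m heights))
      lower : ∀ k → k < a → u (suc k) ⊖ u k ≼ r (suc k) ⊖ r k
      lower zero    0<a   = ≼-telescope (cross 0 0<a) base
      lower (suc k) 1+k<a with attained k (below-m 1+k<a)
      ... | inj₁ Δl≤Δr      = ≼-trans (Interlaced.upper lu k 1+k<a (below-m 1+k<a)) Δl≤Δr
      ... | inj₂ main≤cross = ≼-telescope (cross (suc k) 1+k<a) main≤cross
      upper : ∀ k → suc k < suc m → k < a → r (suc (suc k)) ⊖ r (suc k) ≼ u (suc k) ⊖ u k
      upper k (s≤s k<m) _ = ≼-trans (vertical≤ k k<m) (Interlaced.lower lu k k<m)

    interlaced-down : ∀ {a b} → Heights m a b → Interlaced u r a (suc m) → Interlaced v r b (suc m) →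
                      Interlaced l u m a
    interlaced-down {a} heights ur vr = record { lower = lower ; upper = upper }
      where
      lower : ∀ k → k < m → l (suc k) ⊖ l k ≼ u (suc k) ⊖ u k
      lower k k<m with attained k k<m
      ... | inj₁ Δl≤Δr      = ≼-trans Δl≤Δr (Interlaced.upper ur k (s≤s k<m) (≤-trans k<m (Heights⇒m≤a heights)))
      ... | inj₂ main≤cross = ≼-telescope (≼-swap₂₃ main≤cross)
              (≼-telescope (Interlaced.lower vr k (≤-trans k<m (Heights⇒m≤a (Heights-swap heights))))
                           (≼-swap₁₄ (cross≤ k (<⇒≤ k<m))))
      upper : ∀ k → suc k < a → k < m → u (suc (suc k)) ⊖ u (suc k) ≼ l (suc k) ⊖ l k
      upper k 1+k<a k<m = ≼-trans (Interlaced.lower ur (suc k) 1+k<a) (vertical≤ k k<m)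

    top-supermodular-down : ∀ {a b} → Heights m a b → Interlaced u r a (suc m) → Interlaced v r b (suc m) →
                            (a ≡ b → LastStepRises r (suc m)) → TopSupermodular l u v r m a b
    top-supermodular-down first-taller ur _ _ =
      ≼-swap₁₄ (≼-telescope (Interlaced.lower ur m ≤-refl) (cross≤ m ≤-refl))
    top-supermodular-down second-taller _ vr _ =
      ≼-telescope (Interlaced.lower vr m ≤-refl) (≼-swap₁₄ (cross≤ m ≤-refl))
    top-supermodular-down equal _ _ rises =
      ≼-trans (≼-swap₁₄ (cross≤ m ≤-refl)) (≤⇒≼ (u m) (rises refl))

  last-step-rises-up : ∀ {l u v r m a b} → OctahedronCell l u v r m → LastStepRises l m →
                       a ≡ m → b ≡ m → TopSupermodular l u v r m a b → LastStepRises r (suc m)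
  last-step-rises-up {m = zero} cell _ refl refl top =
    ≼⇒≤ (≼-telescope (≼-swap₁₄ top) (OctahedronCell.base cell))
  last-step-rises-up {l} {m = suc m} cell rises refl refl top with OctahedronCell.attained cell m ≤-refl
  ... | inj₁ Δl≤Δr      = ≼⇒≤ (≼-trans (≤⇒≼ (l m) rises) Δl≤Δr)
  ... | inj₂ main≤cross = ≼⇒≤ (≼-telescope (≼-swap₁₄ top) main≤cross)

  last-step-rises-down : ∀ {l u v r m} → OctahedronCell l u v r m → LastStepRises r (suc m) →
                         LastStepRises l m
  last-step-rises-down {m = zero}          _    _     = ≤ᴳ-refl
  last-step-rises-down {r = r} {m = suc m} cell rises =
    ≼⇒≤ (≼-trans (≤⇒≼ (r (suc m)) rises) (OctahedronCell.vertical≤ cell m ≤-refl))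

module Pyramid {c ℓ₁ ℓ₂} (G : OrderedAbelianGroup c ℓ₁ ℓ₂) (n : ℕ) where
  open OrderedAbelianGroup G hiding (_≤_; refl)
  open OrderedAbelianGroupProperties G
  open IsTotalOrder isTotalOrder using () renaming (reflexive to ≤-reflexive; refl to ≤ᴳ-refl)
  open OAG G n
  open Columns G
  open Coordinates
  open Nat using (zero; suc; _+_; _*_; _⊓_; _≤_; _<_; z≤n; s≤s)
  open Natₚ
    using (*-monoʳ-≤; ≤-refl; ≤-trans; <⇒≤; ⊓-zeroʳ; ⊓-idem; m≤n⊓o⇒m≤n; m≤n⊓o⇒m≤o; m≤n⇒m⊓n≡m; m≥n⇒m⊓n≡n;
           +-suc; m∸n+n≡m)
  open ≡ using (refl; subst)

  -- (F ∘α) X Y is definitionally column F X Y (X ⊓ Y), the top of the column.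
  column : Fun3 → ℕ → ℕ → ℕ → Carrier
  column F X Y k = F (2 * X ∸ k) (2 * Y ∸ k) k

  cell-heights : ∀ X Y → Heights (X ⊓ Y) (suc X ⊓ Y) (X ⊓ suc Y)
  cell-heights zero    zero    = equal
  cell-heights zero    (suc Y) = first-taller
  cell-heights (suc X) zero    = subst (λ b → Heights 0 0 (suc b)) (≡.sym (⊓-zeroʳ X)) second-taller
  cell-heights (suc X) (suc Y) = Heights-suc (cell-heights X Y)

  ColumnsInterlaced : Fun3 → ℕ → ℕ → ℕ → ℕ → Set ℓ₂
  ColumnsInterlaced F X Y X′ Y′ = Interlaced (column F X Y) (column F X′ Y′) (X ⊓ Y) (X′ ⊓ Y′)

  DiagonalRises : Fun3 → ℕ → Set ℓ₂
  DiagonalRises F X = LastStepRises (column F X X) (X ⊓ X)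

  record Interlacing (F : Fun3) : Set ℓ₂ where
    field
      horizontal : ∀ X Y → suc X ≤ n → Y ≤ n → ColumnsInterlaced F X Y (suc X) Y
      vertical   : ∀ X Y → X ≤ n → suc Y ≤ n → ColumnsInterlaced F X Y X (suc Y)
      diagonal   : ∀ X → X ≤ n → DiagonalRises F X

  record BoundaryInterlacing (F : Fun3) : Set ℓ₂ where
    field
      horizontal : ∀ X → suc X ≤ n → Interlaced (column F X n) (column F (suc X) n) X (suc X)
      vertical   : ∀ Y → suc Y ≤ n → Interlaced (column F n Y) (column F n (suc Y)) Y (suc Y)
      corner     : LastStepRises (column F n n) n

  boundary : ∀ {F} → Interlacing F → BoundaryInterlacing F
  boundary {F} I = record
    { horizontal = λ X X<n →
        interlaced-heights (m≤n⇒m⊓n≡m (<⇒≤ X<n)) (m≤n⇒m⊓n≡m X<n) (horizontal X n X<n ≤-refl)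
    ; vertical   = λ Y Y<n →
        interlaced-heights (m≥n⇒m⊓n≡n (<⇒≤ Y<n)) (m≥n⇒m⊓n≡n Y<n) (vertical n Y ≤-refl Y<n)
    ; corner     = subst (LastStepRises (column F n n)) (⊓-idem n) (diagonal n ≤-refl)
    }
    where open Interlacing I

  supermodular-resp-≈ : ∀ {g g′} → (∀ i j → i ≤ n → j ≤ n → g′ i j ≈ g i j) → Supermodular g → Supermodular g′
  supermodular-resp-≈ g′≈g supermodular i j i<n j<n =
    ≤-resp-≈ (∙-cong (sym (g′≈g i (suc j) (<⇒≤ i<n) j<n)) (sym (g′≈g (suc i) j i<n (<⇒≤ j<n))))
             (∙-cong (sym (g′≈g (suc i) (suc j) i<n j<n)) (sym (g′≈g i j (<⇒≤ i<n) (<⇒≤ j<n))))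
             (supermodular i j i<n j<n)

  module _ {F : Fun3} (tp : TropicallyPolarized F) where

    column-base : ∀ {X Y} → X ≤ n → Y ≤ n → column F X Y 0 ≈ ε
    column-base {X} {Y} X≤n Y≤n =
      proj₁ tp (2 * X) (2 * Y) (*-monoʳ-≤ 2 X≤n) (*-monoʳ-≤ 2 Y≤n) (2*m%2≡0 X) (2*m%2≡0 Y)

    α-vanishes-on-axes : VanishesOnAxes (F ∘α)
    α-vanishes-on-axes =
      (λ i i≤n → subst (λ m → column F i 0 m ≈ ε) (≡.sym (⊓-zeroʳ i)) (column-base i≤n z≤n)) ,
      (λ j j≤n → column-base z≤n j≤n)

    column-octahedron : ∀ {X Y k} → suc X ≤ n → suc Y ≤ n → k < X ⊓ Y →
      IsMax (column F X Y (suc k) ∙ column F (suc X) (suc Y) (suc k))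
            (column F X Y k ∙ column F (suc X) (suc Y) (suc (suc k)))
            (column F X (suc Y) (suc k) ∙ column F (suc X) Y (suc k))
    column-octahedron {X} {Y} {k} X<n Y<n k<m
      with column-coordinates (m≤n⊓o⇒m≤n X Y k<m) | column-coordinates (m≤n⊓o⇒m≤o X Y k<m)
    ... | lᵢ , rᵢ , r′ᵢ | lⱼ , rⱼ , r′ⱼ = octahedron-at center lᵢ lⱼ rᵢ rⱼ r′ᵢ r′ⱼ
      where
      k<X : k < X
      k<X = m≤n⊓o⇒m≤n X Y k<m
      k<Y : k < Y
      k<Y = m≤n⊓o⇒m≤o X Y k<m
      center : IsCenter (suc (2 * X ∸ suc k)) (suc (2 * Y ∸ suc k)) (suc k)
      center = (s≤s z≤n , <⇒≤∸1 (≤-trans (s≤s k<X) X<n)) ,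
               (proj₁ (center-coordinate X<n k<X) , proj₁ (center-coordinate Y<n k<Y)) ,
               (proj₂ (center-coordinate X<n k<X) , proj₂ (center-coordinate Y<n k<Y))
      octahedron-at : ∀ {i j K i₁ j₁ i₂ j₂ i₃ j₃} → IsCenter (suc i) (suc j) (suc K) →
        suc i ≡ i₁ → suc j ≡ j₁ → suc (suc i) ≡ i₂ → suc (suc j) ≡ j₂ → suc i ≡ i₃ → suc j ≡ j₃ →
        IsMax (F i j (suc K) ∙ F i₂ j₂ (suc K)) (F i₁ j₁ K ∙ F i₃ j₃ (suc (suc K)))
              (F i j₂ (suc K) ∙ F i₂ j (suc K))
      octahedron-at center refl refl refl refl refl refl = proj₂ tp _ _ _ center

    cell : ∀ {X Y} → suc X ≤ n → suc Y ≤ n →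
      OctahedronCell (column F X Y) (column F (suc X) Y) (column F X (suc Y)) (column F (suc X) (suc Y)) (X ⊓ Y)
    cell {X} {Y} X<n Y<n = record
      { base      = ≤-reflexive (trans (∙-cong l₀ r₀) (sym (∙-cong v₀ u₀)))
      ; cross≤    = cross≤
      ; vertical≤ = λ k k<m → ≼-swap₁₄ (proj₁ (proj₁ (column-octahedron X<n Y<n k<m)))
      ; attained  = λ k k<m →
          map (λ e → ≼-swap₂₃ (≤-reflexive e)) ≤-reflexive (proj₂ (column-octahedron X<n Y<n k<m))
      }
      where
      l₀ : column F X Y 0 ≈ ε
      l₀ = column-base (<⇒≤ X<n) (<⇒≤ Y<n)
      u₀ : column F (suc X) Y 0 ≈ ε
      u₀ = column-base X<n (<⇒≤ Y<n)
      v₀ : column F X (suc Y) 0 ≈ ε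
      v₀ = column-base (<⇒≤ X<n) Y<n
      r₀ : column F (suc X) (suc Y) 0 ≈ ε
      r₀ = column-base X<n Y<n
      cross≤ : ∀ k → k ≤ X ⊓ Y →
               column F (suc X) Y k ⊖ column F X Y k ≼ column F (suc X) (suc Y) k ⊖ column F X (suc Y) k
      cross≤ zero    _   = ≤-reflexive (trans (∙-cong u₀ v₀) (sym (∙-cong r₀ l₀)))
      cross≤ (suc k) k<m = ≼-neg (proj₂ (proj₁ (column-octahedron X<n Y<n k<m)))

    edges-up : ∀ {X Y} → Supermodular (F ∘α) → suc X ≤ n → suc Y ≤ n →
      ColumnsInterlaced F X Y (suc X) Y → ColumnsInterlaced F X Y X (suc Y) →
      ColumnsInterlaced F (suc X) Y (suc X) (suc Y) × ColumnsInterlaced F X (suc Y) (suc X) (suc Y)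
    edges-up {X} {Y} supermodular X<n Y<n lu lv =
      interlaced-up (cell X<n Y<n) (cell-heights X Y) lu lv top ,
      interlaced-up (OctahedronCell-swap (cell X<n Y<n)) (Heights-swap (cell-heights X Y)) lv lu (≼-swap₁₄ top)
      where
      top : TopSupermodular (column F X Y) (column F (suc X) Y) (column F X (suc Y)) (column F (suc X) (suc Y))
                            (X ⊓ Y) (suc X ⊓ Y) (X ⊓ suc Y)
      top = supermodular X Y X<n Y<n

    edges-down : ∀ {X Y} → suc X ≤ n → suc Y ≤ n →
      ColumnsInterlaced F (suc X) Y (suc X) (suc Y) → ColumnsInterlaced F X (suc Y) (suc X) (suc Y) →
      ColumnsInterlaced F X Y (suc X) Y × ColumnsInterlaced F X Y X (suc Y)
    edges-down {X} {Y} X<n Y<n ur vr =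
      interlaced-down (cell X<n Y<n) (cell-heights X Y) ur vr ,
      interlaced-down (OctahedronCell-swap (cell X<n Y<n)) (Heights-swap (cell-heights X Y)) vr ur

    module _ (supermodular : Supermodular (F ∘α)) where

      horizontal-up : ∀ X Y → suc X ≤ n → Y ≤ n → ColumnsInterlaced F X Y (suc X) Y
      vertical-up   : ∀ X Y → X ≤ n → suc Y ≤ n → ColumnsInterlaced F X Y X (suc Y)

      horizontal-up X zero    _   _   =
        subst (λ m → Interlaced (column F X 0) (column F (suc X) 0) m 0) (≡.sym (⊓-zeroʳ X)) interlaced-from-zero
      horizontal-up X (suc Y) X<n Y<n = proj₂ (edges-up supermodular X<n Y<n
        (horizontal-up X Y X<n (<⇒≤ Y<n)) (vertical-up X Y (<⇒≤ X<n) Y<n))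

      vertical-up zero    Y _   _   = interlaced-from-zero
      vertical-up (suc X) Y X<n Y<n = proj₁ (edges-up supermodular X<n Y<n
        (horizontal-up X Y X<n (<⇒≤ Y<n)) (vertical-up X Y (<⇒≤ X<n) Y<n))

      diagonal-up : ∀ X → X ≤ n → DiagonalRises F X
      diagonal-up zero    _   = ≤ᴳ-refl
      diagonal-up (suc X) X<n = last-step-rises-up (cell X<n X<n) (diagonal-up X (<⇒≤ X<n))
        (suc-m⊓m≡m⊓m X) (m⊓suc-m≡m⊓m X) (supermodular X X X<n X<n)

      interlacing-from-supermodular : Interlacing F
      interlacing-from-supermodular = record
        { horizontal = horizontal-up ; vertical = vertical-up ; diagonal = diagonal-up }

    module _ (B : BoundaryInterlacing F) where
      open BoundaryInterlacing B

      horizontal-down : ∀ dx dy {X Y} → dx + suc X ≡ n → dy + Y ≡ n → ColumnsInterlaced F X Y (suc X) Y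
      vertical-down   : ∀ dx dy {X Y} → dx + X ≡ n → dy + suc Y ≡ n → ColumnsInterlaced F X Y X (suc Y)

      horizontal-down dx zero {X} dx+X+1≡n refl =
        interlaced-heights (≡.sym (m≤n⇒m⊓n≡m (<⇒≤ X<n))) (≡.sym (m≤n⇒m⊓n≡m X<n)) (horizontal X X<n)
        where
        X<n : suc X ≤ n
        X<n = d+m≡n⇒m≤n dx+X+1≡n
      horizontal-down dx (suc dy) {X} {Y} dx+X+1≡n dy+Y+1≡n =
        proj₁ (edges-down (d+m≡n⇒m≤n dx+X+1≡n) (d+m≡n⇒m≤n dy+Y+1≡n′)
                          (vertical-down dx dy dx+X+1≡n dy+Y+1≡n′) (horizontal-down dx dy dx+X+1≡n dy+Y+1≡n′))
        where
        dy+Y+1≡n′ : dy + suc Y ≡ n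
        dy+Y+1≡n′ = ≡.trans (+-suc dy Y) dy+Y+1≡n

      vertical-down zero dy {Y = Y} refl dy+Y+1≡n =
        interlaced-heights (≡.sym (m≥n⇒m⊓n≡n (<⇒≤ Y<n))) (≡.sym (m≥n⇒m⊓n≡n Y<n)) (vertical Y Y<n)
        where
        Y<n : suc Y ≤ n
        Y<n = d+m≡n⇒m≤n dy+Y+1≡n
      vertical-down (suc dx) dy {X} {Y} dx+X+1≡n dy+Y+1≡n =
        proj₂ (edges-down (d+m≡n⇒m≤n dx+X+1≡n′) (d+m≡n⇒m≤n dy+Y+1≡n)
                          (vertical-down dx dy dx+X+1≡n′ dy+Y+1≡n) (horizontal-down dx dy dx+X+1≡n′ dy+Y+1≡n))
        where
        dx+X+1≡n′ : dx + suc X ≡ n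
        dx+X+1≡n′ = ≡.trans (+-suc dx X) dx+X+1≡n

      diagonal-down : ∀ d {X} → d + X ≡ n → DiagonalRises F X
      diagonal-down zero    refl = subst (LastStepRises (column F n n)) (≡.sym (⊓-idem n)) corner
      diagonal-down (suc d) {X} d+X+1≡n = last-step-rises-down (cell X<n X<n) (diagonal-down d d+X+1≡n′)
        where
        d+X+1≡n′ : d + suc X ≡ n
        d+X+1≡n′ = ≡.trans (+-suc d X) d+X+1≡n
        X<n : suc X ≤ n
        X<n = d+m≡n⇒m≤n d+X+1≡n′

      interlacing-from-boundary : Interlacing F
      interlacing-from-boundary = record
        { horizontal = λ X Y X<n Y≤n → horizontal-down (n ∸ suc X) (n ∸ Y) (m∸n+n≡m X<n) (m∸n+n≡m Y≤n)
        ; vertical   = λ X Y X≤n Y<n → vertical-down (n ∸ X) (n ∸ suc Y) (m∸n+n≡m X≤n) (m∸n+n≡m Y<n)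
        ; diagonal   = λ X X≤n → diagonal-down (n ∸ X) (m∸n+n≡m X≤n)
        }

    supermodular-from-interlacing : Interlacing F → Supermodular (F ∘α)
    supermodular-from-interlacing I X Y X<n Y<n = top-supermodular-down (cell X<n Y<n) (cell-heights X Y)
      (vertical (suc X) Y X<n Y<n) (horizontal X (suc Y) X<n Y<n) rises
      where
      open Interlacing I
      rises : suc X ⊓ Y ≡ X ⊓ suc Y → LastStepRises (column F (suc X) (suc Y)) (suc (X ⊓ Y))
      rises e with suc-m⊓n≡m⊓suc-n⇒m≡n X Y e
      ... | refl = diagonal (suc X) X<n

module Inframodularity {c ℓ₁ ℓ₂} (G : OrderedAbelianGroup c ℓ₁ ℓ₂) (n : ℕ) where
  open OrderedAbelianGroup G hiding (_≤_; refl)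
  open OrderedAbelianGroup G using () renaming (_≤_ to _≤ᴳ_)
  open OrderedAbelianGroupProperties G
  open OAG G n
  open Columns G
  open Pyramid G n
  open Coordinates
  open Nat using (suc; _+_; _*_; _⊓_; _≤_; _<_; z≤n; s≤s)
  open Natₚ
    using (≤-refl; ≤-trans; <⇒≤; n≤1+n; m≤m+n; m∸n≤m; m∸n+n≡m; +-suc; +-identityʳ; +-monoˡ-≤; ⊓-comm;
           m≤n⇒m⊓n≡m; ≤-<-connex; <-≤-connex; m≤n⇒∃[o]m+o≡n)
  open CommutativeSemigroupProperties Natₚ.+-commutativeSemigroup using () renaming (xy∙z≈xz∙y to +-right-comm)
  open ≡ using (refl; cong; subst)

  transpose : Fun3 → Fun3
  transpose F i j k = F j i k

  β-transpose : ∀ F i j → (F ∘β) j i ≡ (transpose F ∘β) i j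
  β-transpose F i j = cong (λ m → F ((2 * n ∸ 2 * j) + m) ((2 * n ∸ 2 * i) + m) m) (⊓-comm j i)

  β-diagonal : ∀ {F d k j Y} → k + d ≡ j → Y + d ≡ n → k ≤ Y → (F ∘β) k j ≡ column F n Y k
  β-diagonal {F} {d} {k} {Y = Y} refl Y+d≡n k≤Y = begin
      F ((2 * n ∸ 2 * k) + k ⊓ (k + d)) ((2 * n ∸ 2 * (k + d)) + k ⊓ (k + d)) (k ⊓ (k + d))
    ≡⟨ cong (λ m → F ((2 * n ∸ 2 * k) + m) ((2 * n ∸ 2 * (k + d)) + m) m) (m≤n⇒m⊓n≡m (m≤m+n k d)) ⟩
      F ((2 * n ∸ 2 * k) + k) ((2 * n ∸ 2 * (k + d)) + k) k
    ≡⟨ ≡.cong₂ (λ a b → F a b k) (proj₁ (β-coordinates Y+d≡n k≤Y)) (proj₂ (β-coordinates Y+d≡n k≤Y)) ⟩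
      column F n Y k
    ∎
    where open ≡.≡-Reasoning

  β-vanishes-on-axes : ∀ {F} → TropicallyPolarized F → VanishesOnAxes (F ∘β)
  β-vanishes-on-axes {F} tp =
    (λ i i≤n → trans (reflexive (first-axis i≤n)) (column-base tp (m∸n≤m n i) ≤-refl)) ,
    (λ j j≤n → trans (reflexive (second-axis j≤n)) (column-base tp ≤-refl (m∸n≤m n j)))
    where
    first-axis : ∀ {i} → i ≤ n → (F ∘β) i 0 ≡ column F (n ∸ i) n 0
    first-axis {i} i≤n =
      ≡.trans (β-transpose F 0 i) (β-diagonal {transpose F} {d = i} {Y = n ∸ i} refl (m∸n+n≡m i≤n) z≤n)
    second-axis : ∀ {j} → j ≤ n → (F ∘β) 0 j ≡ column F n (n ∸ j) 0
    second-axis {j} j≤n = β-diagonal {F} {d = j} {Y = n ∸ j} refl (m∸n+n≡m j≤n) z≤n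

  DiagonalsAreColumns : Fun2 → (ℕ → ℕ → Carrier) → Set ℓ₁
  DiagonalsAreColumns h C = ∀ {d k j Y} → k + d ≡ j → Y + d ≡ n → k ≤ Y → h k j ≈ C Y k

  module _ {F : Fun3} {h : Fun2} (β≈h : ∀ i j → i ≤ n → j ≤ n → (F ∘β) i j ≈ h i j) where

    private
      bounds : ∀ {d k j Y} → k + d ≡ j → Y + d ≡ n → k ≤ Y → k ≤ n × j ≤ n
      bounds {d} {Y = Y} k+d≡j Y+d≡n k≤Y =
        ≤-trans k≤Y (subst (Y ≤_) Y+d≡n (m≤m+n Y d)) , ≡.subst₂ _≤_ k+d≡j Y+d≡n (+-monoˡ-≤ d k≤Y)

    β-diagonals : DiagonalsAreColumns h (column F n)
    β-diagonals k+d≡j Y+d≡n k≤Y =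
      trans (sym (β≈h _ _ (proj₁ (bounds k+d≡j Y+d≡n k≤Y)) (proj₂ (bounds k+d≡j Y+d≡n k≤Y))))
            (reflexive (β-diagonal {F} k+d≡j Y+d≡n k≤Y))

    β-diagonals-flip : DiagonalsAreColumns (flip h) (λ Y → column F Y n)
    β-diagonals-flip {k = k} {j} k+d≡j Y+d≡n k≤Y =
      trans (sym (β≈h _ _ (proj₂ (bounds k+d≡j Y+d≡n k≤Y)) (proj₁ (bounds k+d≡j Y+d≡n k≤Y))))
            (reflexive (≡.trans (β-transpose F k j) (β-diagonal {transpose F} k+d≡j Y+d≡n k≤Y)))

  InframodularAt₁ InframodularAt₂ : Fun2 → ℕ → ℕ → Set ℓ₂
  InframodularAt₁ h i j = (h i j ∙ h (suc i) (suc (suc j))) ≤ᴳ (h i (suc j) ∙ h (suc i) (suc j))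
  InframodularAt₂ h i j = (h i j ∙ h (suc (suc i)) (suc j)) ≤ᴳ (h (suc i) j ∙ h (suc i) (suc j))

  record UpperInframodular (h : Fun2) : Set ℓ₂ where
    field
      first  : ∀ i j → i ≤ j → suc (suc j) ≤ n → InframodularAt₁ h i j
      second : ∀ i j → suc i ≤ j → suc j ≤ n → InframodularAt₂ h i j

  inframodular-flip : ∀ {h} → Inframodular h → Inframodular (flip h)
  inframodular-flip (first , second) =
    (λ i j i<n j+1<n → second j i j+1<n i<n) , (λ i j i+1<n j<n → first j i j<n i+1<n)

  inframodular-from-upper : ∀ {h} → UpperInframodular h → UpperInframodular (flip h) → Inframodular h
  inframodular-from-upper {h} upper upperᵗ = first , second
    where
    first : ∀ i j → suc i ≤ n → suc (suc j) ≤ n → InframodularAt₁ h i j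
    first i j i<n j+2≤n with ≤-<-connex i j
    ... | inj₁ i≤j = UpperInframodular.first upper i j i≤j j+2≤n
    ... | inj₂ j<i = UpperInframodular.second upperᵗ j i j<i i<n
    second : ∀ i j → suc (suc i) ≤ n → suc j ≤ n → InframodularAt₂ h i j
    second i j i+2≤n j<n with <-≤-connex i j
    ... | inj₁ i<j = UpperInframodular.second upper i j i<j j<n
    ... | inj₂ j≤i = UpperInframodular.first upperᵗ j i j≤i i+2≤n

  module _ {h : Fun2} {C : ℕ → ℕ → Carrier} (diagonals : DiagonalsAreColumns h C) where

    -- Around the point (k, k + d), the diagonals of h of offsets d and d + 1 are the columns suc Y and Y.
    module _ {Y d k : ℕ} (e : suc Y + d ≡ n) (k<Y : k < Y) where
      private
        e′ : Y + suc d ≡ n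
        e′ = ≡.trans (+-suc Y d) e
        on-k : h k (k + d) ≈ C (suc Y) k
        on-k = diagonals refl e (≤-trans (<⇒≤ k<Y) (n≤1+n Y))
        on-k+1 : h (suc k) (suc (k + d)) ≈ C (suc Y) (suc k)
        on-k+1 = diagonals refl e (s≤s (<⇒≤ k<Y))
        on-k+2 : h (suc (suc k)) (suc (suc (k + d))) ≈ C (suc Y) (suc (suc k))
        on-k+2 = diagonals refl e (s≤s k<Y)
        above-k : h k (suc (k + d)) ≈ C Y k
        above-k = diagonals (+-suc k d) e′ (<⇒≤ k<Y)
        above-k+1 : h (suc k) (suc (suc (k + d))) ≈ C Y (suc k)
        above-k+1 = diagonals (cong suc (+-suc k d)) e′ k<Y

      first⇒lower : InframodularAt₁ h k (k + d) → C Y (suc k) ⊖ C Y k ≼ C (suc Y) (suc k) ⊖ C (suc Y) k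
      first⇒lower ineq = ≼-neg (≼-resp-≈ on-k on-k+1 above-k above-k+1 ineq)

      lower⇒first : C Y (suc k) ⊖ C Y k ≼ C (suc Y) (suc k) ⊖ C (suc Y) k → InframodularAt₁ h k (k + d)
      lower⇒first Δ = ≼-resp-≈ (sym on-k) (sym on-k+1) (sym above-k) (sym above-k+1) (≼-neg Δ)

      second⇒upper : InframodularAt₂ h k (suc (k + d)) →
                     C (suc Y) (suc (suc k)) ⊖ C (suc Y) (suc k) ≼ C Y (suc k) ⊖ C Y k
      second⇒upper ineq = ≼-neg (≼-resp-≈ above-k above-k+1 on-k+1 on-k+2 ineq)

      upper⇒second : C (suc Y) (suc (suc k)) ⊖ C (suc Y) (suc k) ≼ C Y (suc k) ⊖ C Y k →
                     InframodularAt₂ h k (suc (k + d))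
      upper⇒second Δ = ≼-resp-≈ (sym above-k) (sym above-k+1) (sym on-k+1) (sym on-k+2) (≼-neg Δ)

    interlaced-from-inframodular : Inframodular h → ∀ Y → suc Y ≤ n → Interlaced (C Y) (C (suc Y)) Y (suc Y)
    interlaced-from-inframodular (first , second) Y Y<n with m≤n⇒∃[o]m+o≡n Y<n
    ... | d , e = record
      { lower = λ k k<Y → first⇒lower e k<Y (first k (k + d) (≤-trans k<Y (<⇒≤ Y<n)) (bound k<Y))
      ; upper = λ k _ k<Y → second⇒upper e k<Y (second k (suc (k + d)) (≤-trans (s≤s k<Y) Y<n) (bound k<Y))
      }
      where
      bound : ∀ {k} → k < Y → suc (suc (k + d)) ≤ n
      bound k<Y = subst (_ ≤_) e (+-monoˡ-≤ d (s≤s k<Y))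

    upper-inframodular-from-interlaced : (∀ Y → suc Y ≤ n → Interlaced (C Y) (C (suc Y)) Y (suc Y)) →
                                         UpperInframodular h
    upper-inframodular-from-interlaced interlaced = record { first = first ; second = second }
      where
      column-end : ∀ i d q → suc (suc (i + d)) + q ≡ n → suc (suc (i + q)) + d ≡ n
      column-end i d q e = ≡.trans (cong (λ m → suc (suc m)) (+-right-comm i q d)) e
      interlaced-at : ∀ i d q → suc (suc (i + d)) + q ≡ n →
                      Interlaced (C (suc (i + q))) (C (suc (suc (i + q)))) (suc (i + q)) (suc (suc (i + q)))
      interlaced-at i d q e = interlaced (suc (i + q)) (subst (_ ≤_) (column-end i d q e) (m≤m+n _ d))
      i<1+i+q : ∀ i q → i < suc (i + q)
      i<1+i+q i q = s≤s (m≤m+n i q)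
      first : ∀ i j → i ≤ j → suc (suc j) ≤ n → InframodularAt₁ h i j
      first i j i≤j j+2≤n with m≤n⇒∃[o]m+o≡n i≤j
      ... | d , refl with m≤n⇒∃[o]m+o≡n j+2≤n
      ... | q , e = lower⇒first (column-end i d q e) (i<1+i+q i q)
                      (Interlaced.lower (interlaced-at i d q e) i (i<1+i+q i q))
      second : ∀ i j → suc i ≤ j → suc j ≤ n → InframodularAt₂ h i j
      second i j i<j j<n with m≤n⇒∃[o]m+o≡n i<j
      ... | d , refl with m≤n⇒∃[o]m+o≡n j<n
      ... | q , e = upper⇒second (column-end i d q e) (i<1+i+q i q)
                      (Interlaced.upper (interlaced-at i d q e) i (s≤s (i<1+i+q i q)) (i<1+i+q i q))

  module _ {F : Fun3} {h : Fun2} (β≈h : ∀ i j → i ≤ n → j ≤ n → (F ∘β) i j ≈ h i j) where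

    private
      on-diagonal : ∀ k → k ≤ n → h k k ≈ column F n n k
      on-diagonal k k≤n = β-diagonals {F} β≈h (+-identityʳ k) (+-identityʳ n) k≤n

    boundary-from-inframodular : Inframodular h → h (n ∸ 1) (n ∸ 1) ≤ᴳ h n n → BoundaryInterlacing F
    boundary-from-inframodular inframodular corner = record
      { horizontal = interlaced-from-inframodular (β-diagonals-flip {F} β≈h) (inframodular-flip inframodular)
      ; vertical   = interlaced-from-inframodular (β-diagonals {F} β≈h) inframodular
      ; corner     = ≤-resp-≈ (on-diagonal (n ∸ 1) (m∸n≤m n 1)) (on-diagonal n ≤-refl) corner
      }

    inframodular-from-boundary : BoundaryInterlacing F → Inframodular h × h (n ∸ 1) (n ∸ 1) ≤ᴳ h n n
    inframodular-from-boundary B =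
      inframodular-from-upper (upper-inframodular-from-interlaced (β-diagonals {F} β≈h) vertical)
                              (upper-inframodular-from-interlaced (β-diagonals-flip {F} β≈h) horizontal) ,
      ≤-resp-≈ (sym (on-diagonal (n ∸ 1) (m∸n≤m n 1))) (sym (on-diagonal n ≤-refl)) corner
      where open BoundaryInterlacing B

theorem3 : ∀ {c ℓ₁ ℓ₂ : Level} (G : OrderedAbelianGroup c ℓ₁ ℓ₂) (n : ℕ) →
    let open OrderedAbelianGroup G
        open OAG G n
    in (∀ (g : Fun2) (f : Fun3) → Supermodular g → VanishesOnAxes g →
          TropicallyPolarized f → (∀ i j → i Data.Nat.≤ n → j Data.Nat.≤ n → (f ∘α) i j ≈ g i j) →
          Inframodular (f ∘β) × VanishesOnAxes (f ∘β) × (f ∘β) (n ∸ 1) (n ∸ 1) ≤ (f ∘β) n n)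
       × (∀ (h : Fun2) (f : Fun3) → Inframodular h → VanishesOnAxes h → h (n ∸ 1) (n ∸ 1) ≤ h n n →
          TropicallyPolarized f → (∀ i j → i Data.Nat.≤ n → j Data.Nat.≤ n → (f ∘β) i j ≈ h i j) →
          Supermodular (f ∘α) × VanishesOnAxes (f ∘α))
theorem3 G n =
  (λ g f supermodular _ tp α≈g →
    let interlacing = interlacing-from-supermodular tp (supermodular-resp-≈ α≈g supermodular)
        inframodular , corner = inframodular-from-boundary (λ _ _ _ _ → refl) (boundary interlacing)
    in inframodular , β-vanishes-on-axes tp , corner) ,
  (λ h f inframodular _ corner tp β≈h →
    let interlacing = interlacing-from-boundary tp (boundary-from-inframodular β≈h inframodular corner)
    in supermodular-from-interlacing tp interlacing , α-vanishes-on-axes tp)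
  where
  open OrderedAbelianGroup G using (refl)
  open Pyramid G n
  open Inframodularity G n
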